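{- Let $f(t)=\sum_{m=0}^{\infty}a_m t^m$ be a formal power series with complex coefficients and let $x,y,z$ be indeterminates. Then, as identities of formal power series in $x,y,z$, $$\sum_{n=0}^{\infty}x^n\left\{\sum_{k=0}^n\binom{n}{k}(-1)^k f(y+zk)\right\} = \sum_{m=0}^{\infty}a_m\left\{\sum_{p=0}^m\binom{m}{p}z^p y^{m-p}\omega_p(-x)\right\},$$ and, in the case $y=0$, $$\sum_{n=0}^{\infty}x^n\left\{\sum_{k=0}^n\binom{n}{k}(-1)^k f(zk)\right\} = \sum_{m=0}^{\infty}a_m z^m\omega_m(-x).$$
   Context: $S(m,n)$ denotes the Stirling numbers of the second kind, $S(m,n)=\frac{(-1)^n}{n!}\sum_{k=0}^n\binom{n}{k}(-1)^k k^m$. The geometric polynomials are $\omega_m(x)=\sum_{n=0}^m S(m,n)\,n!\,x^n$ for $m\ge 0$. -}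

module Defs where

open import Level using (Level)
open import Data.Nat using (ℕ; zero; suc; _∸_; _!)
import Data.Nat as N
open import Data.Nat.Properties using (_!≢0)
open import Data.Nat.Combinatorics using (_C_)
open import Data.Integer as Z using (ℤ; +_; -[1+_]; _/ℕ_)
open import Algebra.Bundles using (CommutativeRing)

-- Stirling numbers of the second kind, by the explicit formula
--   S(m,n) = ((-1)^n / n!) * Σ_{k=0}^n C(n,k) (-1)^k k^m
-- (the division by n! is exact; computed in ℤ).

sumℤ : ℕ → (ℕ → ℤ) → ℤ
sumℤ zero    g = g 0
sumℤ (suc n) g = sumℤ n g Z.+ g (suc n)

signℤ : ℕ → ℤ
signℤ zero    = + 1
signℤ (suc k) = Z.- signℤ k

Stirling2 : ℕ → ℕ → ℤ
Stirling2 m n =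
  (signℤ n Z.* sumℤ n (λ k → + (n C k) Z.* signℤ k Z.* + (k N.^ m))) /ℕ (n !)
  where instance _ = n !≢0

-- coefficient of x^n in the geometric polynomial ω_m(x) = Σ_n S(m,n) n! x^n
geomCoeff : ℕ → ℕ → ℤ
geomCoeff m n = Stirling2 m n Z.* + (n !)

-- Formal power series in three indeterminates x, y, z over a
-- commutative ring R, represented by coefficient functions:
-- F n i j is the coefficient of x^n y^i z^j.

module PowerSeries {c ℓ : Level} (R : CommutativeRing c ℓ) where
  open CommutativeRing R

  sumR : ℕ → (ℕ → Carrier) → Carrier
  sumR zero    g = g 0
  sumR (suc n) g = sumR n g + g (suc n)

  natC : ℕ → Carrier
  natC zero    = 0#
  natC (suc n) = 1# + natC n

  intC : ℤ → Carrier
  intC (+ n)     = natC n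
  intC -[1+ n ]  = - natC (suc n)

  PS3 : Set c
  PS3 = ℕ → ℕ → ℕ → Carrier

  _≈₃_ : PS3 → PS3 → Set ℓ
  F ≈₃ G = ∀ n i j → F n i j ≈ G n i j

  _⊕_ : PS3 → PS3 → PS3
  (F ⊕ G) n i j = F n i j + G n i j

  neg : PS3 → PS3
  neg F n i j = - F n i j

  scale : Carrier → PS3 → PS3
  scale r F n i j = r * F n i j

  _⊗_ : PS3 → PS3 → PS3
  (F ⊗ G) n i j =
    sumR n (λ n₁ → sumR i (λ i₁ → sumR j (λ j₁ →
      F n₁ i₁ j₁ * G (n ∸ n₁) (i ∸ i₁) (j ∸ j₁))))

  one : PS3
  one zero zero zero = 1#
  one _    _    _    = 0#

  X Y Z : PS3
  X (suc zero) zero zero = 1#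
  X _ _ _ = 0#
  Y zero (suc zero) zero = 1#
  Y _ _ _ = 0#
  Z zero zero (suc zero) = 1#
  Z _ _ _ = 0#

  pow : PS3 → ℕ → PS3
  pow F zero    = one
  pow F (suc m) = F ⊗ pow F m

  fsum : ℕ → (ℕ → PS3) → PS3
  fsum n G a i j = sumR n (λ k → G k a i j)

  -- Infinite sum Σ_{n≥0} G n for a family in which G n has x-order ≥ n
  -- (the only families it is applied to): the coefficient of x^n y^i z^j
  -- only receives contributions from G 0, ..., G n.
  sumX : (ℕ → PS3) → PS3
  sumX G n i j = sumR n (λ k → G k n i j)

  -- Infinite sum Σ_{m≥0} G m for a family in which G m has total order
  -- ≥ m in (y,z) (the only families it is applied to): the coefficient
  -- of x^n y^i z^j only receives contributions from G 0, ..., G (i+j).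
  sumYZ : (ℕ → PS3) → PS3
  sumYZ G n i j = sumR (i N.+ j) (λ m → G m n i j)

  -- f(H) = Σ_m a_m H^m for f(t) = Σ_m a_m t^m and H a series in y,z
  -- with zero constant term (so H^m has (y,z)-order ≥ m).
  subst : (ℕ → Carrier) → PS3 → PS3
  subst a H = sumYZ (λ m → scale (a m) (pow H m))

  sign : ℕ → Carrier
  sign k = intC (signℤ k)

  ω : ℕ → PS3 → PS3
  ω m G = fsum m (λ n → scale (intC (geomCoeff m n)) (pow G n))

module Submission where

-- Write
--   A(p,n) = Σ_{k ≤ n} C(n,k) (-1)^k k^p
-- for the alternating power sums.  The x^N y^i z^j coefficient of either
-- left-hand side collapses to (Σ_m a_m q(m,i,j)) · A(j,N), where q(m,i,j)
-- is the y^i z^j coefficient of (y + z)^m resp. z^m: the inner sum over m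
-- is f evaluated termwise, and only x^n·(x-free series) with n = N contributes.
-- The right-hand sides collapse to the same expression once one knows that
-- the x^N coefficient of ω_p(-x), i.e. (-1)^N N! S(p,N), equals A(p,N).
-- That last fact is proved in any commutative ring from the recurrence
-- A(m+1,n+1) = (n+1)(A(m,n+1) - A(m,n)) (Pascal's rule plus absorption),
-- which matches the triangle recurrence of the Stirling numbers; read
-- over ℤ it also shows that the division by n! in the definition of
-- Stirling2 is exact.

open import Defs
open import Level using (Level)
open import Data.Nat using (ℕ; _∸_)
open import Data.Nat.Combinatorics using (_C_)
open import Data.Product using (_×_)
open import Algebra.Bundles using (CommutativeRing)

open import Data.Nat as N using (zero; suc; _≤_; _<_; _≤?_; z≤n; s≤s; _!)
import Data.Nat.Properties as NP
open import Data.Nat.Combinatorics using (nCk+nC[k+1]≡[n+1]C[k+1]; k>n⇒nCk≡0; nC1≡n)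
open import Data.Nat.DivMod using (m*n/n≡m)
open import Data.Integer as Z using (+_; -[1+_])
import Data.Integer.Properties as ZP
open import Data.Product using (_,_)
open import Relation.Nullary using (yes; no)
open import Relation.Binary.PropositionalEquality as P using (_≡_)

-- Absorption identity (k+1)·C(n+1,k+1) = (n+1)·C(n,k); it turns the
-- factor k of k^(m+1) into a factor n+1 in the alternating sums.
C-absorb : ∀ n k → suc k N.* (suc n C suc k) ≡ suc n N.* (n C k)
C-absorb zero    zero    = P.refl
C-absorb zero    (suc k) = P.trans (P.cong (suc (suc k) N.*_) (k>n⇒nCk≡0 {1} {suc (suc k)} (s≤s (s≤s z≤n))))
                          (P.trans (NP.*-zeroʳ (suc (suc k))) (P.sym (P.cong (1 N.*_) (k>n⇒nCk≡0 {0} {suc k} (s≤s z≤n)))))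
C-absorb (suc n) zero    = P.trans (NP.*-identityˡ (suc (suc n) C 1))
                                   (P.trans (nC1≡n (suc (suc n))) (P.sym (NP.*-identityʳ (suc (suc n)))))
C-absorb (suc n) (suc k) = begin
    suc (suc k) N.* (suc (suc n) C suc (suc k))
  ≡⟨ P.cong (suc (suc k) N.*_) (P.sym (nCk+nC[k+1]≡[n+1]C[k+1] (suc n) (suc k))) ⟩
    suc (suc k) N.* (A N.+ B)
  ≡⟨ NP.*-distribˡ-+ (suc (suc k)) A B ⟩
    (A N.+ suc k N.* A) N.+ suc (suc k) N.* B
  ≡⟨ P.cong₂ (λ x y → (A N.+ x) N.+ y) (C-absorb n k) (C-absorb n (suc k)) ⟩
    (A N.+ suc n N.* (n C k)) N.+ suc n N.* (n C suc k)
  ≡⟨ NP.+-assoc A _ _ ⟩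
    A N.+ (suc n N.* (n C k) N.+ suc n N.* (n C suc k))
  ≡⟨ P.cong (A N.+_) (P.sym (NP.*-distribˡ-+ (suc n) (n C k) (n C suc k))) ⟩
    A N.+ suc n N.* (n C k N.+ n C suc k)
  ≡⟨ P.cong (λ x → A N.+ suc n N.* x) (nCk+nC[k+1]≡[n+1]C[k+1] n k) ⟩
    A N.+ suc n N.* A
  ∎
  where
  open P.≡-Reasoning
  A = suc n C suc k
  B = suc n C suc (suc k)

stirling : ℕ → ℕ → ℕ
stirling zero    zero    = 1
stirling zero    (suc n) = 0
stirling (suc m) zero    = 0
stirling (suc m) (suc n) = suc n N.* stirling m (suc n) N.+ stirling m n

stirling-vanish : ∀ {m n} → m < n → stirling m n ≡ 0
stirling-vanish {zero}  {suc n} _         = P.refl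
stirling-vanish {suc m} {suc n} (s≤s m<n) =
  P.cong₂ N._+_ (P.trans (P.cong (suc n N.*_) (stirling-vanish (NP.m<n⇒m<1+n m<n))) (NP.*-zeroʳ (suc n)))
                (stirling-vanish m<n)

module RingFacts {c ℓ : Level} (R : CommutativeRing c ℓ) where
  open CommutativeRing R
  open PowerSeries R
  open import Algebra.Properties.Ring ring using (-1*x≈-x; -0#≈0#; -‿involutive)
  open import Algebra.Properties.Semiring.Exp semiring public using (_^_)
  open import Algebra.Solver.Ring.NaturalCoefficients.Default commutativeSemiring
  open import Relation.Binary.Reasoning.Setoid setoid

  sum-cong : ∀ n {f g : ℕ → Carrier} → (∀ k → f k ≈ g k) → sumR n f ≈ sumR n g
  sum-cong zero    f≈g = f≈g 0
  sum-cong (suc n) f≈g = +-cong (sum-cong n f≈g) (f≈g (suc n))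

  sum-zero : ∀ n {f : ℕ → Carrier} → (∀ k → f k ≈ 0#) → sumR n f ≈ 0#
  sum-zero zero    f≈0 = f≈0 0
  sum-zero (suc n) f≈0 = trans (+-cong (sum-zero n f≈0) (f≈0 (suc n))) (+-identityˡ 0#)

  sum-shift : ∀ n (f : ℕ → Carrier) → sumR (suc n) f ≈ f 0 + sumR n (λ k → f (suc k))
  sum-shift zero    f = refl
  sum-shift (suc n) f = trans (+-congʳ (sum-shift n f)) (+-assoc _ _ _)

  sum-+ : ∀ n (f g : ℕ → Carrier) → sumR n (λ k → f k + g k) ≈ sumR n f + sumR n g
  sum-+ zero    f g = refl
  sum-+ (suc n) f g = begin
      sumR n (λ k → f k + g k) + (f (suc n) + g (suc n))
    ≈⟨ +-congʳ (sum-+ n f g) ⟩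
      (sumR n f + sumR n g) + (f (suc n) + g (suc n))
    ≈⟨ solve 4 (λ a b c d → (a :+ b) :+ (c :+ d) := (a :+ c) :+ (b :+ d)) refl
         (sumR n f) (sumR n g) (f (suc n)) (g (suc n)) ⟩
      (sumR n f + f (suc n)) + (sumR n g + g (suc n))
    ∎

  sum-*ˡ : ∀ n x (f : ℕ → Carrier) → x * sumR n f ≈ sumR n (λ k → x * f k)
  sum-*ˡ zero    x f = refl
  sum-*ˡ (suc n) x f = trans (distribˡ x _ _) (+-congʳ (sum-*ˡ n x f))

  sum-*ʳ : ∀ n x (f : ℕ → Carrier) → sumR n f * x ≈ sumR n (λ k → f k * x)
  sum-*ʳ zero    x f = refl
  sum-*ʳ (suc n) x f = trans (distribʳ x _ _) (+-congʳ (sum-*ʳ n x f))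

  natC-+ : ∀ m n → natC (m N.+ n) ≈ natC m + natC n
  natC-+ zero    n = sym (+-identityˡ _)
  natC-+ (suc m) n = trans (+-congˡ (natC-+ m n)) (sym (+-assoc _ _ _))

  natC-* : ∀ m n → natC (m N.* n) ≈ natC m * natC n
  natC-* zero    n = sym (zeroˡ _)
  natC-* (suc m) n = begin
      natC (n N.+ m N.* n)          ≈⟨ natC-+ n (m N.* n) ⟩
      natC n + natC (m N.* n)       ≈⟨ +-cong (sym (*-identityˡ _)) (natC-* m n) ⟩
      1# * natC n + natC m * natC n ≈⟨ distribʳ _ _ _ ⟨
      (1# + natC m) * natC n        ∎

  natC-zero : ∀ {n} → n ≡ 0 → natC n ≈ 0#
  natC-zero P.refl = refl

  intC-neg : ∀ z → intC (Z.- z) ≈ - intC z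
  intC-neg (+ zero)  = sym -0#≈0#
  intC-neg (+ suc n) = refl
  intC-neg -[1+ n ]  = sym (-‿involutive _)

  sign-suc : ∀ k → sign (suc k) ≈ - 1# * sign k
  sign-suc k = trans (intC-neg (signℤ k)) (sym (-1*x≈-x (sign k)))

  sign-power : ∀ k → sign k ≈ (- 1#) ^ k
  sign-power zero    = +-identityʳ 1#
  sign-power (suc k) = trans (sign-suc k) (*-congˡ (sign-power k))

  sign-square : ∀ k → sign k * sign k ≈ 1#
  sign-square zero    = trans (*-cong (+-identityʳ 1#) (+-identityʳ 1#)) (*-identityˡ 1#)
  sign-square (suc k) = begin
      sign (suc k) * sign (suc k)
    ≈⟨ *-cong (sign-suc k) (sign-suc k) ⟩
      (- 1# * sign k) * (- 1# * sign k)
    ≈⟨ solve 2 (λ u s → (u :* s) :* (u :* s) := (u :* u) :* (s :* s)) refl (- 1#) (sign k) ⟩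
      (- 1# * - 1#) * (sign k * sign k)
    ≈⟨ *-cong (trans (-1*x≈-x (- 1#)) (-‿involutive 1#)) (sign-square k) ⟩
      1# * 1#
    ≈⟨ *-identityˡ 1# ⟩
      1#
    ∎

  -- The alternating power sum  A(m,n) = Σ_{k ≤ n} C(n,k) (-1)^k k^m,
  -- i.e. (-1)^n times the n-th forward difference of k ↦ k^m at 0.
  alternatingSum : ℕ → ℕ → Carrier
  alternatingSum m n = sumR n (λ k → (natC (n C k) * sign k) * natC k ^ m)

  shiftedSum : ℕ → ℕ → Carrier
  shiftedSum m n = sumR n (λ k → (natC (n C k) * sign k) * natC (suc k) ^ m)

  -- Raising the exponent: one factor k is absorbed into C(n+1,k), so
  -- A(m+1,n+1) = -(n+1) · Σ_{j ≤ n} C(n,j) (-1)^j (j+1)^m.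
  alternatingSum-exponent : ∀ m n → alternatingSum (suc m) (suc n) ≈ - 1# * (natC (suc n) * shiftedSum m n)
  alternatingSum-exponent m n = begin
      alternatingSum (suc m) (suc n)
    ≈⟨ sum-shift n _ ⟩
      (natC 1 * sign 0) * (0# * natC 0 ^ m) + sumR n (λ j → term (suc j))
    ≈⟨ +-cong (trans (*-congˡ (zeroˡ _)) (zeroʳ _)) (sum-cong n absorbed) ⟩
      0# + sumR n (λ j → - 1# * (natC (suc n) * shifted j))
    ≈⟨ +-identityˡ _ ⟩
      sumR n (λ j → - 1# * (natC (suc n) * shifted j))
    ≈⟨ sum-*ˡ n (- 1#) _ ⟨
      - 1# * sumR n (λ j → natC (suc n) * shifted j)
    ≈⟨ *-congˡ (sum-*ˡ n (natC (suc n)) shifted) ⟨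
      - 1# * (natC (suc n) * shiftedSum m n)
    ∎
    where
    term : ℕ → Carrier
    term k = (natC (suc n C k) * sign k) * natC k ^ suc m
    shifted : ℕ → Carrier
    shifted j = (natC (n C j) * sign j) * natC (suc j) ^ m
    absorb : ∀ j → natC (suc j) * natC (suc n C suc j) ≈ natC (suc n) * natC (n C j)
    absorb j = trans (sym (natC-* (suc j) (suc n C suc j)))
                 (trans (reflexive (P.cong natC (C-absorb n j))) (natC-* (suc n) (n C j)))
    absorbed : ∀ j → term (suc j) ≈ - 1# * (natC (suc n) * shifted j)
    absorbed j = begin
        (natC (suc n C suc j) * sign (suc j)) * (natC (suc j) * natC (suc j) ^ m)
      ≈⟨ *-congʳ (*-congˡ (sign-suc j)) ⟩
        (natC (suc n C suc j) * (- 1# * sign j)) * (natC (suc j) * natC (suc j) ^ m)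
      ≈⟨ solve 5 (λ b u s k q → (b :* (u :* s)) :* (k :* q) := u :* ((k :* b) :* (s :* q))) refl
           (natC (suc n C suc j)) (- 1#) (sign j) (natC (suc j)) (natC (suc j) ^ m) ⟩
        - 1# * ((natC (suc j) * natC (suc n C suc j)) * (sign j * natC (suc j) ^ m))
      ≈⟨ *-congˡ (*-congʳ (absorb j)) ⟩
        - 1# * ((natC (suc n) * natC (n C j)) * (sign j * natC (suc j) ^ m))
      ≈⟨ solve 5 (λ u a b s q → u :* ((a :* b) :* (s :* q)) := u :* (a :* ((b :* s) :* q))) refl
           (- 1#) (natC (suc n)) (natC (n C j)) (sign j) (natC (suc j) ^ m) ⟩
        - 1# * (natC (suc n) * shifted j)
      ∎

  -- Raising the order by Pascal's rule:  A(m,n+1) = A(m,n) - Σ_{j ≤ n} C(n,j) (-1)^j (j+1)^m.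
  alternatingSum-order : ∀ m n → alternatingSum m (suc n) ≈ alternatingSum m n + - 1# * shiftedSum m n
  alternatingSum-order m n = begin
      alternatingSum m (suc n)
    ≈⟨ sum-shift n _ ⟩
      term 0 + sumR n (λ j → (natC (suc n C suc j) * sign (suc j)) * natC (suc j) ^ m)
    ≈⟨ +-congˡ (sum-cong n pascal) ⟩
      term 0 + sumR n (λ j → term (suc j) + - 1# * shifted j)
    ≈⟨ +-congˡ (trans (sum-+ n _ _) (+-congˡ (sym (sum-*ˡ n (- 1#) shifted)))) ⟩
      term 0 + (sumR n (λ j → term (suc j)) + - 1# * shiftedSum m n)
    ≈⟨ +-assoc _ _ _ ⟨
      (term 0 + sumR n (λ j → term (suc j))) + - 1# * shiftedSum m n
    ≈⟨ +-congʳ (sum-shift n term) ⟨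
      (alternatingSum m n + term (suc n)) + - 1# * shiftedSum m n
    ≈⟨ +-congʳ (trans (+-congˡ top-term) (+-identityʳ _)) ⟩
      alternatingSum m n + - 1# * shiftedSum m n
    ∎
    where
    term : ℕ → Carrier
    term k = (natC (n C k) * sign k) * natC k ^ m
    shifted : ℕ → Carrier
    shifted j = (natC (n C j) * sign j) * natC (suc j) ^ m
    top-term : term (suc n) ≈ 0#
    top-term = trans (*-congʳ (trans (*-congʳ (natC-zero (k>n⇒nCk≡0 (NP.n<1+n n)))) (zeroˡ _))) (zeroˡ _)
    pascal : ∀ j → (natC (suc n C suc j) * sign (suc j)) * natC (suc j) ^ m ≈ term (suc j) + - 1# * shifted j
    pascal j = begin
        (natC (suc n C suc j) * sign (suc j)) * natC (suc j) ^ m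
      ≈⟨ *-congʳ (*-cong (trans (reflexive (P.cong natC (P.sym (nCk+nC[k+1]≡[n+1]C[k+1] n j))))
                                (natC-+ (n C j) (n C suc j)))
                         (sign-suc j)) ⟩
        ((natC (n C j) + natC (n C suc j)) * (- 1# * sign j)) * natC (suc j) ^ m
      ≈⟨ solve 5 (λ a b u s q → ((a :+ b) :* (u :* s)) :* q := (b :* (u :* s)) :* q :+ u :* ((a :* s) :* q)) refl
           (natC (n C j)) (natC (n C suc j)) (- 1#) (sign j) (natC (suc j) ^ m) ⟩
        (natC (n C suc j) * (- 1# * sign j)) * natC (suc j) ^ m + - 1# * shifted j
      ≈⟨ +-congʳ (*-congʳ (*-congˡ (sign-suc j))) ⟨
        term (suc j) + - 1# * shifted j
      ∎

  -- Eliminating the shifted sum:  A(m+1,n+1) = (n+1) · (A(m,n+1) - A(m,n)).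
  alternatingSum-recurrence : ∀ m n →
    alternatingSum (suc m) (suc n) ≈ natC (suc n) * (alternatingSum m (suc n) + - 1# * alternatingSum m n)
  alternatingSum-recurrence m n = sym (begin
      natC (suc n) * (alternatingSum m (suc n) + - 1# * alternatingSum m n)
    ≈⟨ *-congˡ (+-congʳ (alternatingSum-order m n)) ⟩
      natC (suc n) * ((alternatingSum m n + - 1# * shiftedSum m n) + - 1# * alternatingSum m n)
    ≈⟨ solve 4 (λ k a s u → k :* ((a :+ u :* s) :+ u :* a) := u :* (k :* s) :+ k :* ((con 1 :+ u) :* a)) refl
         (natC (suc n)) (alternatingSum m n) (shiftedSum m n) (- 1#) ⟩
      - 1# * (natC (suc n) * shiftedSum m n) + natC (suc n) * ((1# + - 1#) * alternatingSum m n)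
    ≈⟨ +-congˡ (trans (*-congˡ (trans (*-congʳ (-‿inverseʳ 1#)) (zeroˡ _))) (zeroʳ _)) ⟩
      - 1# * (natC (suc n) * shiftedSum m n) + 0#
    ≈⟨ trans (+-identityʳ _) (sym (alternatingSum-exponent m n)) ⟩
      alternatingSum (suc m) (suc n)
    ∎)

  alternatingSum-stirling : ∀ m n → alternatingSum m n ≈ sign n * natC (n ! N.* stirling m n)
  alternatingSum-stirling zero    zero    = *-identityʳ _
  alternatingSum-stirling zero    (suc n) = begin
      alternatingSum 0 (suc n)
    ≈⟨ alternatingSum-order 0 n ⟩
      alternatingSum 0 n + - 1# * alternatingSum 0 n
    ≈⟨ +-congʳ (*-identityˡ _) ⟨
      1# * alternatingSum 0 n + - 1# * alternatingSum 0 n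
    ≈⟨ distribʳ _ _ _ ⟨
      (1# + - 1#) * alternatingSum 0 n
    ≈⟨ trans (*-congʳ (-‿inverseʳ 1#)) (zeroˡ _) ⟩
      0#
    ≈⟨ trans (*-congˡ (natC-zero (NP.*-zeroʳ (suc n !)))) (zeroʳ _) ⟨
      sign (suc n) * natC (suc n ! N.* 0)
    ∎
  alternatingSum-stirling (suc m) zero    = trans (*-congˡ (zeroˡ _)) (trans (zeroʳ _) (sym (zeroʳ _)))
  alternatingSum-stirling (suc m) (suc n) = begin
      alternatingSum (suc m) (suc n)
    ≈⟨ alternatingSum-recurrence m n ⟩
      k * (alternatingSum m (suc n) + - 1# * alternatingSum m n)
    ≈⟨ *-congˡ (+-cong (alternatingSum-stirling m (suc n)) (*-congˡ (alternatingSum-stirling m n))) ⟩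
      k * (sign (suc n) * natC ((suc n) ! N.* a) + - 1# * (sign n * natC (n ! N.* b)))
    ≈⟨ *-congˡ (+-cong (*-cong (sign-suc n) (trans (natC-* (suc n N.* n !) a) (*-congʳ (natC-* (suc n) (n !)))))
                       (*-congˡ (*-congˡ (natC-* (n !) b)))) ⟩
      k * ((- 1# * sign n) * ((k * f) * natC a) + - 1# * (sign n * (f * natC b)))
    ≈⟨ solve 6 (λ k u s f a b → k :* ((u :* s) :* ((k :* f) :* a) :+ u :* (s :* (f :* b)))
                             := (u :* s) :* ((k :* f) :* (k :* a :+ b))) refl
         k (- 1#) (sign n) f (natC a) (natC b) ⟩
      (- 1# * sign n) * ((k * f) * (k * natC a + natC b))
    ≈⟨ *-cong (sign-suc n) (trans (natC-* (suc n N.* n !) _)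
                (*-cong (natC-* (suc n) (n !)) (trans (natC-+ (suc n N.* a) b) (+-congʳ (natC-* (suc n) a))))) ⟨
      sign (suc n) * natC (suc n ! N.* stirling (suc m) (suc n))
    ∎
    where
    k = natC (suc n)
    f = natC (n !)
    a = stirling m (suc n)
    b = stirling m n

  stirling-explicit : ∀ m n → sign n * alternatingSum m n ≈ natC (n ! N.* stirling m n)
  stirling-explicit m n = begin
      sign n * alternatingSum m n
    ≈⟨ *-congˡ (alternatingSum-stirling m n) ⟩
      sign n * (sign n * natC (n ! N.* stirling m n))
    ≈⟨ *-assoc _ _ _ ⟨
      (sign n * sign n) * natC (n ! N.* stirling m n)
    ≈⟨ trans (*-congʳ (sign-square n)) (*-identityˡ _) ⟩
      natC (n ! N.* stirling m n)
    ∎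

module ℤSeries = PowerSeries ZP.+-*-commutativeRing
module ℤFacts = RingFacts ZP.+-*-commutativeRing

natC≡+ : ∀ n → ℤSeries.natC n ≡ + n
natC≡+ zero    = P.refl
natC≡+ (suc n) = P.cong (Z._+_ (+ 1)) (natC≡+ n)

intC≡id : ∀ z → ℤSeries.intC z ≡ z
intC≡id (+ n)     = natC≡+ n
intC≡id -[1+ n ]  = P.cong Z.-_ (natC≡+ (suc n))

+-^ : ∀ k m → (+ k) ℤFacts.^ m ≡ + (k N.^ m)
+-^ k zero    = P.refl
+-^ k (suc m) = P.trans (P.cong (+ k Z.*_) (+-^ k m)) (P.sym (ZP.pos-* k (k N.^ m)))

sumℤ≡sumR : ∀ n g → sumℤ n g ≡ ℤSeries.sumR n g
sumℤ≡sumR zero    g = P.refl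
sumℤ≡sumR (suc n) g = P.cong (Z._+ g (suc n)) (sumℤ≡sumR n g)

-- (-1)^n A(m,n) = n! S(m,n) from RingFacts makes the division by n! exact.
Stirling2≡stirling : ∀ m n → Stirling2 m n ≡ + stirling m n
Stirling2≡stirling m n = begin
    (signℤ n Z.* sumℤ n (λ k → + (n C k) Z.* signℤ k Z.* + (k N.^ m))) Z./ℕ (n !)
  ≡⟨ P.cong (λ s → s Z./ℕ (n !)) (P.cong₂ Z._*_ (P.sym (intC≡id (signℤ n))) alternating) ⟩
    (ℤSeries.sign n Z.* ℤFacts.alternatingSum m n) Z./ℕ (n !)
  ≡⟨ P.cong (λ s → s Z./ℕ (n !)) (P.trans (ℤFacts.stirling-explicit m n) (natC≡+ _)) ⟩
    + ((n ! N.* stirling m n) N./ n !)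
  ≡⟨ P.cong (λ s → + (s N./ n !)) (NP.*-comm (n !) (stirling m n)) ⟩
    + ((stirling m n N.* n !) N./ n !)
  ≡⟨ P.cong +_ (m*n/n≡m (stirling m n) (n !)) ⟩
    + stirling m n
  ∎
  where
  open P.≡-Reasoning
  instance _ = NP._!≢0 n
  alternating : sumℤ n (λ k → + (n C k) Z.* signℤ k Z.* + (k N.^ m)) ≡ ℤFacts.alternatingSum m n
  alternating = P.trans (sumℤ≡sumR n _) (ℤFacts.sum-cong n (λ k →
    P.sym (P.cong₂ Z._*_ (P.cong₂ Z._*_ (natC≡+ (n C k)) (intC≡id (signℤ k)))
                         (P.trans (P.cong (ℤFacts._^ m) (natC≡+ k)) (+-^ k m)))))

geomCoeff≡ : ∀ m n → geomCoeff m n ≡ + (n ! N.* stirling m n)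
geomCoeff≡ m n = P.trans (P.cong (Z._* + (n !)) (Stirling2≡stirling m n))
                   (P.trans (P.sym (ZP.pos-* (stirling m n) (n !))) (P.cong +_ (NP.*-comm (stirling m n) (n !))))

module Coefficients {c ℓ : Level} (R : CommutativeRing c ℓ) where
  open CommutativeRing R
  open PowerSeries R
  open RingFacts R
  open import Algebra.Properties.Ring ring using (-‿distribˡ-*)
  open import Algebra.Properties.Semiring.Exp semiring using (^-congˡ)
  open import Algebra.Solver.Ring.NaturalCoefficients.Default commutativeSemiring
  open import Relation.Binary.Reasoning.Setoid setoid

  δ : ℕ → ℕ → Carrier
  δ zero    zero    = 1#
  δ zero    (suc n) = 0#
  δ (suc m) zero    = 0#
  δ (suc m) (suc n) = δ m n

  ι : ℕ → ℕ → Carrier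
  ι zero    n       = 1#
  ι (suc m) zero    = 0#
  ι (suc m) (suc n) = ι m n

  δ-sym : ∀ m n → δ m n ≈ δ n m
  δ-sym zero    zero    = refl
  δ-sym zero    (suc n) = refl
  δ-sym (suc m) zero    = refl
  δ-sym (suc m) (suc n) = δ-sym m n

  δ-subst : ∀ m n (f : ℕ → Carrier) → δ m n * f m ≈ δ m n * f n
  δ-subst zero    zero    f = refl
  δ-subst zero    (suc n) f = trans (zeroˡ _) (sym (zeroˡ _))
  δ-subst (suc m) zero    f = trans (zeroˡ _) (sym (zeroˡ _))
  δ-subst (suc m) (suc n) f = δ-subst m n (λ k → f (suc k))

  ι-≤ : ∀ {m n} → m ≤ n → ι m n ≈ 1#
  ι-≤ z≤n       = refl
  ι-≤ (s≤s m≤n) = ι-≤ m≤n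

  ι-> : ∀ {m n} → n < m → ι m n ≈ 0#
  ι-> {suc m} {zero}  _         = refl
  ι-> {suc m} {suc n} (s≤s n<m) = ι-> n<m

  δ-sum : ∀ n t (f : ℕ → Carrier) → sumR n (λ k → δ t k * f k) ≈ ι t n * f t
  δ-sum zero    zero    f = refl
  δ-sum zero    (suc t) f = trans (zeroˡ _) (sym (zeroˡ _))
  δ-sum (suc n) zero    f = trans (sum-shift n _) (trans (+-congˡ (sum-zero n (λ k → zeroˡ _))) (+-identityʳ _))
  δ-sum (suc n) (suc t) f =
    trans (sum-shift n _) (trans (+-congʳ (zeroˡ _)) (trans (+-identityˡ _) (δ-sum n t (λ k → f (suc k)))))

  ι-δ : ∀ a b n → ι a n * δ b (n ∸ a) ≈ δ (a N.+ b) n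
  ι-δ zero    b n       = *-identityˡ _
  ι-δ (suc a) b zero    = zeroˡ _
  ι-δ (suc a) b (suc n) = ι-δ a b n

  ι-δ₀ : ∀ a n → ι a n * δ 0 (n ∸ a) ≈ δ a n
  ι-δ₀ a n = trans (ι-δ a 0 n) (reflexive (P.cong (λ t → δ t n) (NP.+-identityʳ a)))

  ≈₃-refl : ∀ {F} → F ≈₃ F
  ≈₃-refl n i j = refl

  ≈₃-trans : ∀ {F G H} → F ≈₃ G → G ≈₃ H → F ≈₃ H
  ≈₃-trans F≈G G≈H n i j = trans (F≈G n i j) (G≈H n i j)

  ⊗-cong : ∀ {F F′ G G′} → F ≈₃ F′ → G ≈₃ G′ → (F ⊗ G) ≈₃ (F′ ⊗ G′)
  ⊗-cong F≈ G≈ n i j = sum-cong n (λ n₁ → sum-cong i (λ i₁ → sum-cong j (λ j₁ → *-cong (F≈ _ _ _) (G≈ _ _ _))))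

  ⊗-distribʳ : ∀ F G H n i j → ((F ⊕ G) ⊗ H) n i j ≈ (F ⊗ H) n i j + (G ⊗ H) n i j
  ⊗-distribʳ F G H n i j =
    trans (sum-cong n (λ n₁ → trans (sum-cong i (λ i₁ → trans (sum-cong j (λ j₁ → distribʳ _ _ _)) (sum-+ j _ _)))
                                    (sum-+ i _ _)))
          (sum-+ n _ _)

  1^n≈1 : ∀ n → 1# ^ n ≈ 1#
  1^n≈1 zero    = refl
  1^n≈1 (suc n) = trans (*-identityˡ _) (1^n≈1 n)

  monomial : Carrier → ℕ → ℕ → ℕ → PS3
  monomial c a i j n i′ j′ = c * (δ a n * (δ i i′ * δ j j′))

  monomial-cong : ∀ {c c′ a a′ i i′ j j′} → c ≈ c′ → a ≡ a′ → i ≡ i′ → j ≡ j′ →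
                  monomial c a i j ≈₃ monomial c′ a′ i′ j′
  monomial-cong c≈c′ P.refl P.refl P.refl n i j = *-congʳ c≈c′

  private
    hit : 1# * (1# * (1# * 1#)) ≈ 1#
    hit = trans (*-identityˡ _) (trans (*-identityˡ _) (*-identityˡ _))
    miss-x : ∀ w → 1# * (0# * w) ≈ 0#
    miss-x w = trans (*-identityˡ _) (zeroˡ w)
    miss-y : ∀ d w → 1# * (d * (0# * w)) ≈ 0#
    miss-y d w = trans (*-identityˡ _) (trans (*-congˡ (zeroˡ w)) (zeroʳ d))
    miss-z : ∀ d e → 1# * (d * (e * 0#)) ≈ 0#
    miss-z d e = trans (*-identityˡ _) (trans (*-congˡ (zeroʳ e)) (zeroʳ d))

  one-monomial : one ≈₃ monomial 1# 0 0 0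
  one-monomial zero    zero    zero    = sym hit
  one-monomial zero    zero    (suc j) = sym (miss-z _ _)
  one-monomial zero    (suc i) j       = sym (miss-y _ _)
  one-monomial (suc n) i       j       = sym (miss-x _)

  X-monomial : X ≈₃ monomial 1# 1 0 0
  X-monomial zero          i       j       = sym (miss-x _)
  X-monomial (suc zero)    zero    zero    = sym hit
  X-monomial (suc zero)    zero    (suc j) = sym (miss-z _ _)
  X-monomial (suc zero)    (suc i) j       = sym (miss-y _ _)
  X-monomial (suc (suc n)) i       j       = sym (miss-x _)

  Y-monomial : Y ≈₃ monomial 1# 0 1 0
  Y-monomial (suc n) i             j       = sym (miss-x _)
  Y-monomial zero    zero          j       = sym (miss-y _ _)
  Y-monomial zero    (suc zero)    zero    = sym hit
  Y-monomial zero    (suc zero)    (suc j) = sym (miss-z _ _)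
  Y-monomial zero    (suc (suc i)) j       = sym (miss-y _ _)

  Z-monomial : Z ≈₃ monomial 1# 0 0 1
  Z-monomial (suc n) i       j             = sym (miss-x _)
  Z-monomial zero    (suc i) j             = sym (miss-y _ _)
  Z-monomial zero    zero    zero          = sym (miss-z _ _)
  Z-monomial zero    zero    (suc zero)    = sym hit
  Z-monomial zero    zero    (suc (suc j)) = sym (miss-z _ _)

  scale-monomial : ∀ {F} d c a i j → F ≈₃ monomial c a i j → scale d F ≈₃ monomial (d * c) a i j
  scale-monomial d c a i j F≈ n i′ j′ = trans (*-congˡ (F≈ n i′ j′)) (sym (*-assoc _ _ _))

  neg-monomial : ∀ {F} c a i j → F ≈₃ monomial c a i j → neg F ≈₃ monomial (- c) a i j
  neg-monomial c a i j F≈ n i′ j′ = trans (-‿cong (F≈ n i′ j′)) (-‿distribˡ-* _ _)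

  monomial-⊗ : ∀ c a i j F n i′ j′ →
    (monomial c a i j ⊗ F) n i′ j′ ≈ ι a n * (ι i i′ * (ι j j′ * (c * F (n ∸ a) (i′ ∸ i) (j′ ∸ j))))
  monomial-⊗ c a i j F n i′ j′ = begin
      (monomial c a i j ⊗ F) n i′ j′
    ≈⟨ sum-cong n (λ n₁ → sum-cong i′ (λ i₁ → sum-cong j′ (λ j₁ →
         solve 5 (λ c d e f w → c :* (d :* (e :* f)) :* w := d :* (e :* (f :* (c :* w)))) refl
           c (δ a n₁) (δ i i₁) (δ j j₁) (F (n ∸ n₁) (i′ ∸ i₁) (j′ ∸ j₁))))) ⟩
      sumR n (λ n₁ → sumR i′ (λ i₁ → sumR j′ (λ j₁ → δ a n₁ * (δ i i₁ * (δ j j₁ * W n₁ i₁ j₁)))))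
    ≈⟨ sum-cong n (λ n₁ → trans (sum-cong i′ (λ i₁ → sym (sum-*ˡ j′ (δ a n₁) _))) (sym (sum-*ˡ i′ (δ a n₁) _))) ⟩
      sumR n (λ n₁ → δ a n₁ * sumR i′ (λ i₁ → sumR j′ (λ j₁ → δ i i₁ * (δ j j₁ * W n₁ i₁ j₁))))
    ≈⟨ δ-sum n a _ ⟩
      ι a n * sumR i′ (λ i₁ → sumR j′ (λ j₁ → δ i i₁ * (δ j j₁ * W a i₁ j₁)))
    ≈⟨ *-congˡ (trans (sum-cong i′ (λ i₁ → sym (sum-*ˡ j′ (δ i i₁) _))) (δ-sum i′ i _)) ⟩
      ι a n * (ι i i′ * sumR j′ (λ j₁ → δ j j₁ * W a i j₁))
    ≈⟨ *-congˡ (*-congˡ (δ-sum j′ j _)) ⟩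
      ι a n * (ι i i′ * (ι j j′ * (c * F (n ∸ a) (i′ ∸ i) (j′ ∸ j))))
    ∎
    where
    W : ℕ → ℕ → ℕ → Carrier
    W n₁ i₁ j₁ = c * F (n ∸ n₁) (i′ ∸ i₁) (j′ ∸ j₁)

  monomial-⊗-monomial : ∀ c a i j d a′ i′ j′ →
    (monomial c a i j ⊗ monomial d a′ i′ j′) ≈₃ monomial (c * d) (a N.+ a′) (i N.+ i′) (j N.+ j′)
  monomial-⊗-monomial c a i j d a′ i′ j′ n i″ j″ = begin
      (monomial c a i j ⊗ monomial d a′ i′ j′) n i″ j″
    ≈⟨ monomial-⊗ c a i j (monomial d a′ i′ j′) n i″ j″ ⟩
      ι a n * (ι i i″ * (ι j j″ * (c * (d * (δ a′ (n ∸ a) * (δ i′ (i″ ∸ i) * δ j′ (j″ ∸ j)))))))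
    ≈⟨ solve 8 (λ c d la li lj da di dj → la :* (li :* (lj :* (c :* (d :* (da :* (di :* dj))))))
                                        := (c :* d) :* ((la :* da) :* ((li :* di) :* (lj :* dj)))) refl
         c d (ι a n) (ι i i″) (ι j j″) (δ a′ (n ∸ a)) (δ i′ (i″ ∸ i)) (δ j′ (j″ ∸ j)) ⟩
      (c * d) * ((ι a n * δ a′ (n ∸ a)) * ((ι i i″ * δ i′ (i″ ∸ i)) * (ι j j″ * δ j′ (j″ ∸ j))))
    ≈⟨ *-congˡ (*-cong (ι-δ a a′ n) (*-cong (ι-δ i i′ i″) (ι-δ j j′ j″))) ⟩
      monomial (c * d) (a N.+ a′) (i N.+ i′) (j N.+ j′) n i″ j″
    ∎

  pow-monomial : ∀ {F} c a i j → F ≈₃ monomial c a i j → ∀ m →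
                 pow F m ≈₃ monomial (c ^ m) (m N.* a) (m N.* i) (m N.* j)
  pow-monomial c a i j F≈ zero    = one-monomial
  pow-monomial c a i j F≈ (suc m) =
    ≈₃-trans (⊗-cong F≈ (pow-monomial c a i j F≈ m)) (monomial-⊗-monomial c a i j (c ^ m) _ _ _)

  pow-X : ∀ n → pow X n ≈₃ monomial 1# n 0 0
  pow-X n = ≈₃-trans (pow-monomial 1# 1 0 0 X-monomial n)
                     (monomial-cong (1^n≈1 n) (NP.*-identityʳ n) (NP.*-zeroʳ n) (NP.*-zeroʳ n))

  pow-Y : ∀ n → pow Y n ≈₃ monomial 1# 0 n 0
  pow-Y n = ≈₃-trans (pow-monomial 1# 0 1 0 Y-monomial n)
                     (monomial-cong (1^n≈1 n) (NP.*-zeroʳ n) (NP.*-identityʳ n) (NP.*-zeroʳ n))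

  pow-Z : ∀ n → pow Z n ≈₃ monomial 1# 0 0 n
  pow-Z n = ≈₃-trans (pow-monomial 1# 0 0 1 Z-monomial n)
                     (monomial-cong (1^n≈1 n) (NP.*-zeroʳ n) (NP.*-zeroʳ n) (NP.*-identityʳ n))

  pow-cZ : ∀ c n → pow (scale c Z) n ≈₃ monomial (c ^ n) 0 0 n
  pow-cZ c n = ≈₃-trans (pow-monomial (c * 1#) 0 0 1 (scale-monomial c 1# 0 0 1 Z-monomial) n)
                        (monomial-cong (^-congˡ n (*-identityʳ c)) (NP.*-zeroʳ n) (NP.*-zeroʳ n) (NP.*-identityʳ n))

  pow-negX : ∀ n → pow (neg X) n ≈₃ monomial (sign n) n 0 0
  pow-negX n = ≈₃-trans (pow-monomial (- 1#) 1 0 0 (neg-monomial 1# 1 0 0 X-monomial) n)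
                        (monomial-cong (sym (sign-power n)) (NP.*-identityʳ n) (NP.*-zeroʳ n) (NP.*-zeroʳ n))

  pow-Z⊗pow-Y : ∀ p q → (pow Z p ⊗ pow Y q) ≈₃ monomial 1# 0 q p
  pow-Z⊗pow-Y p q = ≈₃-trans (⊗-cong (pow-Z p) (pow-Y q))
                      (≈₃-trans (monomial-⊗-monomial 1# 0 0 p 1# 0 q 0)
                                (monomial-cong {a = 0} {i = q} (*-identityˡ 1#) P.refl P.refl (NP.+-identityʳ p)))

  pow-X-⊗ : ∀ n F N i j → (pow X n ⊗ F) N i j ≈ ι n N * F (N ∸ n) i j
  pow-X-⊗ n F N i j = trans (⊗-cong {G = F} (pow-X n) ≈₃-refl N i j)
    (trans (monomial-⊗ 1# n 0 0 F N i j) (*-congˡ (trans (*-identityˡ _) (trans (*-identityˡ _) (*-identityˡ _)))))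

  sumX-xfree : ∀ (G : ℕ → PS3) (g : ℕ → ℕ → ℕ → Carrier) → (∀ n b i j → G n b i j ≈ δ 0 b * g n i j) →
               ∀ N i j → sumX (λ n → pow X n ⊗ G n) N i j ≈ g N i j
  sumX-xfree G g G≈ N i j = begin
      sumR N (λ n → (pow X n ⊗ G n) N i j)
    ≈⟨ sum-cong N (λ n → trans (pow-X-⊗ n (G n) N i j) (*-congˡ (G≈ n (N ∸ n) i j))) ⟩
      sumR N (λ n → ι n N * (δ 0 (N ∸ n) * g n i j))
    ≈⟨ sum-cong N (λ n → trans (sym (*-assoc _ _ _)) (*-congʳ (trans (ι-δ₀ n N) (δ-sym n N)))) ⟩
      sumR N (λ n → δ N n * g n i j)
    ≈⟨ δ-sum N N _ ⟩
      ι N N * g N i j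
    ≈⟨ trans (*-congʳ (ι-≤ (NP.≤-refl {N}))) (*-identityˡ _) ⟩
      g N i j
    ∎

  -- ι n p · n! S(p,n) = n! S(p,n): the Stirling numbers vanish beyond the degree
  stirling-degree : ∀ p n → ι n p * natC (n ! N.* stirling p n) ≈ natC (n ! N.* stirling p n)
  stirling-degree p n with n ≤? p
  ... | yes n≤p = trans (*-congʳ (ι-≤ n≤p)) (*-identityˡ _)
  ... | no  n≰p = trans (*-congʳ (ι-> (NP.≰⇒> n≰p))) (trans (zeroˡ _) (sym (natC-zero
                    (P.trans (P.cong (n ! N.*_) (stirling-vanish (NP.≰⇒> n≰p))) (NP.*-zeroʳ (n !))))))

  ω-neg-X : ∀ p n i j → ω p (neg X) n i j ≈ δ 0 i * (δ 0 j * alternatingSum p n)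
  ω-neg-X p n i j = begin
      sumR p (λ k → intC (geomCoeff p k) * pow (neg X) k n i j)
    ≈⟨ sum-cong p (λ k → trans (*-congˡ (pow-negX k n i j))
         (trans (solve 5 (λ g s d e f → g :* (s :* (d :* (e :* f))) := d :* ((e :* f) :* (g :* s))) refl
                   (intC (geomCoeff p k)) (sign k) (δ k n) (δ 0 i) (δ 0 j))
                (*-congʳ (δ-sym k n)))) ⟩
      sumR p (λ k → δ n k * ((δ 0 i * δ 0 j) * (intC (geomCoeff p k) * sign k)))
    ≈⟨ δ-sum p n _ ⟩
      ι n p * ((δ 0 i * δ 0 j) * (intC (geomCoeff p n) * sign n))
    ≈⟨ *-congˡ (*-congˡ (*-congʳ (reflexive (P.cong intC (geomCoeff≡ p n))))) ⟩
      ι n p * ((δ 0 i * δ 0 j) * (natC (n ! N.* stirling p n) * sign n))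
    ≈⟨ solve 5 (λ l d e s f → l :* ((d :* e) :* (f :* s)) := d :* (e :* (s :* (l :* f)))) refl
         (ι n p) (δ 0 i) (δ 0 j) (sign n) (natC (n ! N.* stirling p n)) ⟩
      δ 0 i * (δ 0 j * (sign n * (ι n p * natC (n ! N.* stirling p n))))
    ≈⟨ *-congˡ (*-congˡ (*-congˡ (stirling-degree p n))) ⟩
      δ 0 i * (δ 0 j * (sign n * natC (n ! N.* stirling p n)))
    ≈⟨ *-congˡ (*-congˡ (alternatingSum-stirling p n)) ⟨
      δ 0 i * (δ 0 j * alternatingSum p n)
    ∎

  monomial-⊗-ω : ∀ p q N i j → (monomial 1# 0 q p ⊗ ω p (neg X)) N i j ≈ δ q i * (δ p j * alternatingSum p N)
  monomial-⊗-ω p q N i j = begin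
      (monomial 1# 0 q p ⊗ ω p (neg X)) N i j
    ≈⟨ monomial-⊗ 1# 0 q p (ω p (neg X)) N i j ⟩
      1# * (ι q i * (ι p j * (1# * ω p (neg X) N (i ∸ q) (j ∸ p))))
    ≈⟨ *-identityˡ _ ⟩
      ι q i * (ι p j * (1# * ω p (neg X) N (i ∸ q) (j ∸ p)))
    ≈⟨ *-congˡ (*-congˡ (trans (*-identityˡ _) (ω-neg-X p N (i ∸ q) (j ∸ p)))) ⟩
      ι q i * (ι p j * (δ 0 (i ∸ q) * (δ 0 (j ∸ p) * alternatingSum p N)))
    ≈⟨ solve 5 (λ lq lp dq dp w → lq :* (lp :* (dq :* (dp :* w))) := (lq :* dq) :* ((lp :* dp) :* w)) refl
         (ι q i) (ι p j) (δ 0 (i ∸ q)) (δ 0 (j ∸ p)) (alternatingSum p N) ⟩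
      (ι q i * δ 0 (i ∸ q)) * ((ι p j * δ 0 (j ∸ p)) * alternatingSum p N)
    ≈⟨ *-cong (ι-δ₀ q i) (*-congʳ (ι-δ₀ p j)) ⟩
      δ q i * (δ p j * alternatingSum p N)
    ∎

  Y⊕cZ-⊗ : ∀ c F b i j → ((Y ⊕ scale c Z) ⊗ F) b i j ≈ ι 1 i * F b (i ∸ 1) j + ι 1 j * (c * F b i (j ∸ 1))
  Y⊕cZ-⊗ c F b i j = trans (⊗-distribʳ Y (scale c Z) F b i j) (+-cong byY byZ)
    where
    byY : (Y ⊗ F) b i j ≈ ι 1 i * F b (i ∸ 1) j
    byY = trans (⊗-cong {G = F} Y-monomial ≈₃-refl b i j)
            (trans (monomial-⊗ 1# 0 1 0 F b i j) (trans (*-identityˡ _) (*-congˡ (trans (*-identityˡ _) (*-identityˡ _)))))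
    byZ : (scale c Z ⊗ F) b i j ≈ ι 1 j * (c * F b i (j ∸ 1))
    byZ = trans (⊗-cong {G = F} (scale-monomial c 1# 0 0 1 Z-monomial) ≈₃-refl b i j)
            (trans (monomial-⊗ (c * 1#) 0 0 1 F b i j)
                   (trans (*-identityˡ _) (trans (*-identityˡ _) (*-congˡ (*-congʳ (*-identityʳ c))))))

  -- (y + c z)^m = Σ_{i+j=m} C(m,j) c^j y^i z^j, as a series in x, y, z
  binomialSeries : Carrier → ℕ → PS3
  binomialSeries c m b i j = δ 0 b * ((δ m (i N.+ j) * natC (m C j)) * c ^ j)

  pascal-term : ∀ c m b j d →
    δ 0 b * ((d * natC (suc m C suc j)) * (c * c ^ j))
      ≈ δ 0 b * ((d * natC (m C suc j)) * (c * c ^ j)) + c * (δ 0 b * ((d * natC (m C j)) * c ^ j))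
  pascal-term c m b j d = begin
      δ 0 b * ((d * natC (suc m C suc j)) * (c * c ^ j))
    ≈⟨ *-congˡ (*-congʳ (*-congˡ (trans (reflexive (P.cong natC (P.sym (nCk+nC[k+1]≡[n+1]C[k+1] m j))))
                                        (natC-+ (m C j) (m C suc j))))) ⟩
      δ 0 b * ((d * (natC (m C j) + natC (m C suc j))) * (c * c ^ j))
    ≈⟨ solve 6 (λ e d u v c q → e :* ((d :* (u :+ v)) :* (c :* q))
                              := e :* ((d :* v) :* (c :* q)) :+ c :* (e :* ((d :* u) :* q))) refl
         (δ 0 b) d (natC (m C j)) (natC (m C suc j)) c (c ^ j) ⟩
      δ 0 b * ((d * natC (m C suc j)) * (c * c ^ j)) + c * (δ 0 b * ((d * natC (m C j)) * c ^ j))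
    ∎

  -- [m = j]·C(m,j+1) = 0: no term y^(-1) z^(j+1) arises in (y + c z)^(m+1)
  δ-C-vanish : ∀ m j → δ m j * natC (m C suc j) ≈ 0#
  δ-C-vanish m j = trans (δ-subst m j (λ t → natC (t C suc j)))
                         (trans (*-congˡ (natC-zero (k>n⇒nCk≡0 (NP.n<1+n j)))) (zeroʳ _))

  binomialSeries-suc : ∀ c m b i j →
    binomialSeries c (suc m) b i j ≈ ι 1 i * binomialSeries c m b (i ∸ 1) j + ι 1 j * (c * binomialSeries c m b i (j ∸ 1))
  binomialSeries-suc c m b zero    zero    =
    trans (*-congˡ (trans (*-congʳ (zeroˡ _)) (zeroˡ _))) (trans (zeroʳ _) (sym (trans (+-cong (zeroˡ _) (zeroˡ _)) (+-identityʳ 0#))))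
  binomialSeries-suc c m b (suc i) zero    = sym (trans (+-cong (*-identityˡ _) (zeroˡ _)) (+-identityʳ _))
  binomialSeries-suc c m b zero    (suc j) = begin
      δ 0 b * ((δ m j * natC (suc m C suc j)) * (c * c ^ j))
    ≈⟨ pascal-term c m b j (δ m j) ⟩
      δ 0 b * ((δ m j * natC (m C suc j)) * (c * c ^ j)) + c * binomialSeries c m b 0 j
    ≈⟨ +-congʳ (trans (*-congˡ (trans (*-congʳ (δ-C-vanish m j)) (zeroˡ _))) (zeroʳ _)) ⟩
      0# + c * binomialSeries c m b 0 j
    ≈⟨ +-cong (zeroˡ _) (*-identityˡ _) ⟨
      0# * binomialSeries c m b 0 (suc j) + 1# * (c * binomialSeries c m b 0 j)
    ∎
  binomialSeries-suc c m b (suc i) (suc j) = begin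
      δ 0 b * ((δ m (i N.+ suc j) * natC (suc m C suc j)) * (c * c ^ j))
    ≈⟨ pascal-term c m b j (δ m (i N.+ suc j)) ⟩
      δ 0 b * ((δ m (i N.+ suc j) * natC (m C suc j)) * (c * c ^ j))
        + c * (δ 0 b * ((δ m (i N.+ suc j) * natC (m C j)) * c ^ j))
    ≈⟨ +-cong (*-identityˡ _) (*-identityˡ _) ⟨
      1# * binomialSeries c m b i (suc j)
        + 1# * (c * (δ 0 b * ((δ m (i N.+ suc j) * natC (m C j)) * c ^ j)))
    ≈⟨ +-congˡ (*-congˡ (*-congˡ (*-congˡ (*-congʳ (*-congʳ (reflexive (P.cong (δ m) (NP.+-suc i j)))))))) ⟩
      1# * binomialSeries c m b i (suc j) + 1# * (c * binomialSeries c m b (suc i) j)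
    ∎

  binomial : ∀ c m → pow (Y ⊕ scale c Z) m ≈₃ binomialSeries c m
  binomial c zero    zero    zero    zero    = sym (trans (*-identityˡ _) (trans (*-identityʳ _) (trans (*-identityˡ _) (+-identityʳ 1#))))
  binomial c zero    zero    zero    (suc j) = sym (trans (*-identityˡ _) (trans (*-congʳ (zeroˡ _)) (zeroˡ _)))
  binomial c zero    zero    (suc i) j       = sym (trans (*-identityˡ _) (trans (*-congʳ (zeroˡ _)) (zeroˡ _)))
  binomial c zero    (suc b) i       j       = sym (zeroˡ _)
  binomial c (suc m) b i j = begin
      ((Y ⊕ scale c Z) ⊗ pow (Y ⊕ scale c Z) m) b i j
    ≈⟨ Y⊕cZ-⊗ c (pow (Y ⊕ scale c Z) m) b i j ⟩
      ι 1 i * pow (Y ⊕ scale c Z) m b (i ∸ 1) j + ι 1 j * (c * pow (Y ⊕ scale c Z) m b i (j ∸ 1))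
    ≈⟨ +-cong (*-congˡ (binomial c m b (i ∸ 1) j)) (*-congˡ (*-congˡ (binomial c m b i (j ∸ 1)))) ⟩
      ι 1 i * binomialSeries c m b (i ∸ 1) j + ι 1 j * (c * binomialSeries c m b i (j ∸ 1))
    ≈⟨ binomialSeries-suc c m b i j ⟨
      binomialSeries c (suc m) b i j
    ∎

  module Identities (a : ℕ → Carrier) where

    binomialTransform : ∀ (H : ℕ → PS3) (q : ℕ → ℕ → ℕ → Carrier) →
      (∀ k m b i j → pow (H k) m b i j ≈ δ 0 b * (q m i j * natC k ^ j)) →
      ∀ N i j → sumX (λ n → pow X n ⊗ fsum n (λ k → scale (natC (n C k) * sign k) (subst a (H k)))) N i j
                ≈ sumR (i N.+ j) (λ m → a m * q m i j) * alternatingSum j N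
    binomialTransform H q H≈ = sumX-xfree _ (λ n i j → Q i j * alternatingSum j n) transformed
      where
      Q : ℕ → ℕ → Carrier
      Q i j = sumR (i N.+ j) (λ m → a m * q m i j)
      substituted : ∀ k b i j → subst a (H k) b i j ≈ δ 0 b * (Q i j * natC k ^ j)
      substituted k b i j = begin
          sumR (i N.+ j) (λ m → a m * pow (H k) m b i j)
        ≈⟨ sum-cong (i N.+ j) (λ m → trans (*-congˡ (H≈ k m b i j))
             (solve 4 (λ a e q w → a :* (e :* (q :* w)) := e :* ((a :* q) :* w)) refl
               (a m) (δ 0 b) (q m i j) (natC k ^ j))) ⟩
          sumR (i N.+ j) (λ m → δ 0 b * ((a m * q m i j) * natC k ^ j))
        ≈⟨ trans (*-congˡ (sum-*ʳ (i N.+ j) (natC k ^ j) _)) (sum-*ˡ (i N.+ j) (δ 0 b) _) ⟨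
          δ 0 b * (Q i j * natC k ^ j)
        ∎
      transformed : ∀ n b i j → fsum n (λ k → scale (natC (n C k) * sign k) (subst a (H k))) b i j
                                ≈ δ 0 b * (Q i j * alternatingSum j n)
      transformed n b i j = begin
          sumR n (λ k → (natC (n C k) * sign k) * subst a (H k) b i j)
        ≈⟨ sum-cong n (λ k → trans (*-congˡ (substituted k b i j))
             (solve 4 (λ w e s p → w :* (e :* (s :* p)) := e :* (s :* (w :* p))) refl
               (natC (n C k) * sign k) (δ 0 b) (Q i j) (natC k ^ j))) ⟩
          sumR n (λ k → δ 0 b * (Q i j * ((natC (n C k) * sign k) * natC k ^ j)))
        ≈⟨ trans (*-congˡ (sum-*ˡ n (Q i j) _)) (sum-*ˡ n (δ 0 b) _) ⟨
          δ 0 b * (Q i j * alternatingSum j n)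
        ∎

    sumYZ-collect : ∀ (G : ℕ → PS3) (q : ℕ → ℕ → ℕ → Carrier) N i j →
      (∀ m → G m N i j ≈ q m i j * alternatingSum j N) →
      sumYZ (λ m → scale (a m) (G m)) N i j ≈ sumR (i N.+ j) (λ m → a m * q m i j) * alternatingSum j N
    sumYZ-collect G q N i j G≈ =
      trans (sum-cong (i N.+ j) (λ m → trans (*-congˡ (G≈ m)) (sym (*-assoc _ _ _))))
            (sym (sum-*ʳ (i N.+ j) (alternatingSum j N) _))

    -- First identity: f(y + kz), with (y + kz)^m = Σ_j C(m,j) k^j y^(m-j) z^j.
    q₁ : ℕ → ℕ → ℕ → Carrier
    q₁ m i j = δ m (i N.+ j) * natC (m C j)

    summand₁ : ℕ → PS3
    summand₁ m = fsum m (λ p → scale (natC (m C p)) ((pow Z p ⊗ pow Y (m ∸ p)) ⊗ ω p (neg X)))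

    -- only p = j contributes, with y-exponent m - p = i
    rhs₁-summand : ∀ m N i j → summand₁ m N i j ≈ q₁ m i j * alternatingSum j N
    rhs₁-summand m N i j = begin
        sumR m (λ p → natC (m C p) * ((pow Z p ⊗ pow Y (m ∸ p)) ⊗ ω p (neg X)) N i j)
      ≈⟨ sum-cong m (λ p → trans (*-congˡ (trans (⊗-cong {G = ω p (neg X)} (pow-Z⊗pow-Y p (m ∸ p)) ≈₃-refl N i j)
                                                  (monomial-⊗-ω p (m ∸ p) N i j)))
           (trans (solve 4 (λ c d e w → c :* (d :* (e :* w)) := e :* (c :* (d :* w))) refl
                     (natC (m C p)) (δ (m ∸ p) i) (δ p j) (alternatingSum p N))
                  (*-congʳ (δ-sym p j)))) ⟩
        sumR m (λ p → δ j p * (natC (m C p) * (δ (m ∸ p) i * alternatingSum p N)))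
      ≈⟨ δ-sum m j _ ⟩
        ι j m * (natC (m C j) * (δ (m ∸ j) i * alternatingSum j N))
      ≈⟨ solve 4 (λ l c d w → l :* (c :* (d :* w)) := ((l :* d) :* c) :* w) refl
           (ι j m) (natC (m C j)) (δ (m ∸ j) i) (alternatingSum j N) ⟩
        ((ι j m * δ (m ∸ j) i) * natC (m C j)) * alternatingSum j N
      ≈⟨ *-congʳ (*-congʳ (trans (*-congˡ (δ-sym (m ∸ j) i)) (trans (ι-δ j i m)
           (trans (δ-sym (j N.+ i) m) (reflexive (P.cong (δ m) (NP.+-comm j i))))))) ⟩
        q₁ m i j * alternatingSum j N
      ∎

    identity₁ : sumX (λ n → pow X n ⊗ fsum n (λ k → scale (natC (n C k) * sign k) (subst a (Y ⊕ scale (natC k) Z))))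
                ≈₃ sumYZ (λ m → scale (a m) (fsum m (λ p → scale (natC (m C p)) ((pow Z p ⊗ pow Y (m ∸ p)) ⊗ ω p (neg X)))))
    identity₁ N i j =
      trans (binomialTransform (λ k → Y ⊕ scale (natC k) Z) q₁ (λ k m → binomial (natC k) m) N i j)
            (sym (sumYZ-collect summand₁ q₁ N i j (λ m → rhs₁-summand m N i j)))

    -- Second identity: f(kz), with (kz)^m = k^m z^m.
    q₂ : ℕ → ℕ → ℕ → Carrier
    q₂ m i j = δ 0 i * δ m j

    -- (kz)^m = k^m z^m, with k^m rewritten as k^j on the support m = j
    pow-kZ : ∀ k m b i j → pow (scale (natC k) Z) m b i j ≈ δ 0 b * (q₂ m i j * natC k ^ j)
    pow-kZ k m b i j = begin
        pow (scale (natC k) Z) m b i j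
      ≈⟨ pow-cZ (natC k) m b i j ⟩
        natC k ^ m * (δ 0 b * (δ 0 i * δ m j))
      ≈⟨ solve 4 (λ w e d f → w :* (e :* (d :* f)) := e :* (d :* (f :* w))) refl
           (natC k ^ m) (δ 0 b) (δ 0 i) (δ m j) ⟩
        δ 0 b * (δ 0 i * (δ m j * natC k ^ m))
      ≈⟨ *-congˡ (*-congˡ (δ-subst m j (natC k ^_))) ⟩
        δ 0 b * (δ 0 i * (δ m j * natC k ^ j))
      ≈⟨ *-congˡ (*-assoc _ _ _) ⟨
        δ 0 b * (q₂ m i j * natC k ^ j)
      ∎

    rhs₂-summand : ∀ m N i j → (pow Z m ⊗ ω m (neg X)) N i j ≈ q₂ m i j * alternatingSum j N
    rhs₂-summand m N i j = begin
        (pow Z m ⊗ ω m (neg X)) N i j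
      ≈⟨ trans (⊗-cong {G = ω m (neg X)} (pow-Z m) ≈₃-refl N i j) (monomial-⊗-ω m 0 N i j) ⟩
        δ 0 i * (δ m j * alternatingSum m N)
      ≈⟨ *-congˡ (δ-subst m j (λ t → alternatingSum t N)) ⟩
        δ 0 i * (δ m j * alternatingSum j N)
      ≈⟨ *-assoc _ _ _ ⟨
        q₂ m i j * alternatingSum j N
      ∎

    identity₂ : sumX (λ n → pow X n ⊗ fsum n (λ k → scale (natC (n C k) * sign k) (subst a (scale (natC k) Z))))
                ≈₃ sumYZ (λ m → scale (a m) (pow Z m ⊗ ω m (neg X)))
    identity₂ N i j =
      trans (binomialTransform (λ k → scale (natC k) Z) q₂ pow-kZ N i j)
            (sym (sumYZ-collect (λ m → pow Z m ⊗ ω m (neg X)) q₂ N i j (λ m → rhs₂-summand m N i j)))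

theorem2 : {c ℓ : Level} (R : CommutativeRing c ℓ) (a : ℕ → CommutativeRing.Carrier R) →
    let open PowerSeries R
        open CommutativeRing R using (_*_)
    in (sumX (λ n → pow X n ⊗ fsum n (λ k → scale (natC (n C k) * sign k) (subst a (Y ⊕ scale (natC k) Z))))
          ≈₃ sumYZ (λ m → scale (a m) (fsum m (λ p → scale (natC (m C p)) ((pow Z p ⊗ pow Y (m ∸ p)) ⊗ ω p (neg X))))))
       × (sumX (λ n → pow X n ⊗ fsum n (λ k → scale (natC (n C k) * sign k) (subst a (scale (natC k) Z))))
          ≈₃ sumYZ (λ m → scale (a m) (pow Z m ⊗ ω m (neg X))))
theorem2 R a = identity₁ , identity₂
  where open Coefficients.Identities R a
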